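{- There exist two feasible brackets $E,E'$ such that for every outcome $O\in\mathcal{B}$, $\max\big(s(E,O),s(E',O)\big)\ge \mathsf{t}/4$; that is, the set $\mathcal{E}=\{E,E'\}$ satisfies $S(\mathcal{E})\ge\mathsf{t}/4$.
   Context: Tournament: there are $\mathsf{t}=2^{\mathsf{r}}$ teams $\mathcal{T}=\{1,\dots,\mathsf{t}\}$ playing a single-elimination tournament with a fixed bracket of $\mathsf{r}$ rounds; round $r$ has $\mathsf{t}/2^r$ games, for $\mathsf{g}=\mathsf{t}-1$ games in total, and $r(g)$ denotes the round of game $g$. Each game $g$ has a set $\mathcal{T}(g)$ of teams that can play in it: the first-round games partition $\mathcal{T}$ into pairs; each game $g$ with $r(g)>1$ has exactly two predecessor games in round $r(g)-1$, whose winners play $g$, and $\mathcal{T}(g)$ is the union of their team sets. For $t\in\mathcal{T}(g)$ with $r(g)>1$, $\gamma^-(g,t)$ is the predecessor game of $g$ with $t\in\mathcal{T}(\gamma^-(g,t))$. A feasible bracket is a matrix $B\in\{0,1\}^{\mathsf{t}\times\mathsf{g}}$ with $\sum_t B_{t,g}=1$ for every game $g$, $B_{t,g}=1$ only if $t\in\mathcal{T}(g)$, and, if $r(g)>1$ and $B_{t,g}=1$, then $B_{t,\gamma^-(g,t)}=1$; $\mathcal{B}$ is the set of feasible brackets. Both entries and outcomes are feasible brackets. The score of entry $E$ under outcome $O$ is $s(E,O)=\sum_{t}\sum_{g}2^{r(g)-1}E_{t,g}O_{t,g}$, and $S(\mathcal{E})=\max_{E\in\mathcal{E}}s(E,O)$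 for the (random) outcome $O$. -}

module Defs where

open import Data.Nat using (ℕ; zero; suc; _+_; _*_; _∸_; _^_; _⊔_; _≤_; _<_)
open import Data.Fin using (Fin; toℕ; zero; suc)
open import Data.Bool using (Bool; true; false; if_then_else_)
open import Data.Product using (Σ; _×_; _,_)
open import Relation.Binary.PropositionalEquality using (_≡_)

sumFin : (n : ℕ) → (Fin n → ℕ) → ℕ
sumFin zero    f = 0
sumFin (suc n) f = f zero + sumFin n (λ i → f (suc i))

bit : Bool → ℕ
bit b = if b then 1 else 0

-- Teams of a tournament with r rounds: Fin t with t = 2^r (team i ↔ 1+i).
teams : ℕ → ℕ
teams r = 2 ^ r

Team : ℕ → Set
Team r = Fin (teams r)

-- Games: a game is a pair (k , j) where k : Fin r encodes round r(g) = 1 + toℕ k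
-- and j indexes the t/2^{r(g)} games of that round (the standard fixed bracket).
Game : ℕ → Set
Game r = Σ (Fin r) (λ k → Fin (2 ^ (r ∸ suc (toℕ k))))

round : ∀ {r} → Game r → ℕ
round (k , j) = suc (toℕ k)

-- t ∈ 𝒯(g): game j of round k' contains teams j·2^{k'} , … , (j+1)·2^{k'} − 1.
-- First-round games are the pairs {2j, 2j+1}; the predecessors of game j of round
-- k'+1 are games 2j and 2j+1 of round k'; 𝒯(g) is the union of their team sets.
_∈T_ : ∀ {r} → Team r → Game r → Set
_∈T_ {r} t (k , j) =
  (toℕ j * 2 ^ suc (toℕ k) ≤ toℕ t) × (toℕ t < suc (toℕ j) * 2 ^ suc (toℕ k))

-- Feasible bracket: a 0/1 matrix B (teams × games) with
--  * exactly one team per game (Σ_t B_{t,g} = 1),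
--  * B_{t,g} = 1 only if t ∈ 𝒯(g),
--  * if r(g) > 1 and B_{t,g} = 1 then B_{t,γ⁻(g,t)} = 1, where γ⁻(g,t) is the
--    game g' of round r(g) − 1 with t ∈ 𝒯(g') (necessarily a predecessor of g).
record Bracket (r : ℕ) : Set where
  field
    B        : Team r → Game r → Bool
    oneWinner : ∀ (g : Game r) → sumFin (teams r) (λ t → bit (B t g)) ≡ 1
    inGame   : ∀ (t : Team r) (g : Game r) → B t g ≡ true → t ∈T g
    advance  : ∀ (t : Team r) (g g' : Game r) →
               round g ≡ suc (round g') → t ∈T g' →
               B t g ≡ true → B t g' ≡ true
open Bracket public

sumGames : (r : ℕ) → (Game r → ℕ) → ℕ
sumGames r f = sumFin r (λ k → sumFin (2 ^ (r ∸ suc (toℕ k))) (λ j → f (k , j)))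

score : ∀ {r} → Bracket r → Bracket r → ℕ
score {r} E O =
  sumFin (teams r) (λ t → sumGames r (λ g →
    2 ^ (round g ∸ 1) * (bit (B E t g) * bit (B O t g))))

{-# OPTIONS --safe #-}
module Submission where

-- E lets the lowest-numbered team win every game and E' the highest-numbered
-- one; both are feasible because the lowest (highest) team of a game is the
-- lowest (highest) team of one of its two predecessor games. Each first-round
-- game {2j, 2j+1} is won by its lower or its upper team, so it is predicted by
-- E or by E'. Summing over the t/2 first-round games gives
-- s(E,O) + s(E',O) ≥ t/2, hence max(s(E,O), s(E',O)) ≥ t/4.

open import Defs
open import Data.Nat using (ℕ; zero; suc; pred; _+_; _*_; _^_; _⊔_; _≤_; _<_; _∸_; _≡ᵇ_; z≤n; s≤s; s≤s⁻¹)
open import Data.Nat.Properties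
open import Data.Fin using (Fin; toℕ; zero; suc)
open import Data.Fin.Properties using (toℕ<n)
open import Data.Bool using (true; false)
open import Data.Bool.Properties using (T-≡)
open import Data.Product using (Σ; _×_; _,_; proj₂)
open import Data.Sum using (_⊎_; inj₁; inj₂)
open import Function.Bundles using (Equivalence)
open import Relation.Binary.PropositionalEquality
  using (_≡_; refl; sym; trans; cong; cong₂; subst; module ≡-Reasoning)
import Algebra.Properties.CommutativeSemigroup as CommSemigroupProperties

open CommSemigroupProperties +-commutativeSemigroup using (interchange)
open Equivalence using (to; from)

sumFin-cong : ∀ n {f g : Fin n → ℕ} → (∀ i → f i ≡ g i) → sumFin n f ≡ sumFin n g
sumFin-cong zero    f≡g = refl
sumFin-cong (suc n) f≡g = cong₂ _+_ (f≡g zero) (sumFin-cong n (λ i → f≡g (suc i)))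

sumFin-mono : ∀ n {f g : Fin n → ℕ} → (∀ i → f i ≤ g i) → sumFin n f ≤ sumFin n g
sumFin-mono zero    f≤g = z≤n
sumFin-mono (suc n) f≤g = +-mono-≤ (f≤g zero) (sumFin-mono n (λ i → f≤g (suc i)))

sumFin-+ : ∀ n (f g : Fin n → ℕ) →
  sumFin n (λ i → f i + g i) ≡ sumFin n f + sumFin n g
sumFin-+ zero    f g = refl
sumFin-+ (suc n) f g = begin
  f zero + g zero + sumFin n (λ i → f (suc i) + g (suc i))
    ≡⟨ cong (f zero + g zero +_) (sumFin-+ n (λ i → f (suc i)) (λ i → g (suc i))) ⟩
  f zero + g zero + (sumFin n (λ i → f (suc i)) + sumFin n (λ i → g (suc i)))
    ≡⟨ interchange (f zero) (g zero) _ _ ⟩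
  f zero + sumFin n (λ i → f (suc i)) + (g zero + sumFin n (λ i → g (suc i))) ∎
  where open ≡-Reasoning

sumFin-const : ∀ n c → sumFin n (λ _ → c) ≡ n * c
sumFin-const zero    c = refl
sumFin-const (suc n) c = cong (c +_) (sumFin-const n c)

sumFin-swap : ∀ n m (f : Fin n → Fin m → ℕ) →
  sumFin n (λ i → sumFin m (f i)) ≡ sumFin m (λ j → sumFin n (λ i → f i j))
sumFin-swap zero    m f = trans (sym (*-zeroʳ m)) (sym (sumFin-const m 0))
sumFin-swap (suc n) m f = begin
  sumFin m (f zero) + sumFin n (λ i → sumFin m (f (suc i)))
    ≡⟨ cong (sumFin m (f zero) +_) (sumFin-swap n m (λ i → f (suc i))) ⟩
  sumFin m (f zero) + sumFin m (λ j → sumFin n (λ i → f (suc i) j))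
    ≡⟨ sym (sumFin-+ m (f zero) (λ j → sumFin n (λ i → f (suc i) j))) ⟩
  sumFin m (λ j → sumFin (suc n) (λ i → f i j)) ∎
  where open ≡-Reasoning

sumFin-indicator : ∀ n c → c < n → sumFin n (λ i → bit (toℕ i ≡ᵇ c)) ≡ 1
sumFin-indicator (suc n) zero    _         = cong suc (trans (sumFin-const n 0) (*-zeroʳ n))
sumFin-indicator (suc n) (suc c) (s≤s c<n) = sumFin-indicator n c c<n

≡ᵇ-true⇒≡ : ∀ {m n} → (m ≡ᵇ n) ≡ true → m ≡ n
≡ᵇ-true⇒≡ {m} {n} eq = ≡ᵇ⇒≡ m n (from T-≡ eq)

≡⇒≡ᵇ-true : ∀ {m n} → m ≡ n → (m ≡ᵇ n) ≡ true
≡⇒≡ᵇ-true {m} {n} eq = to T-≡ (≡⇒≡ᵇ m n eq)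

InBlock : ℕ → ℕ → ℕ → Set
InBlock M J c = J * M ≤ c × c < suc J * M

block-index-≤ : ∀ {M J J' c} → J * M ≤ c → c < suc J' * M → J ≤ J'
block-index-≤ {M} {J} {J'} lo hi = s≤s⁻¹ (*-cancelʳ-< M J (suc J') (≤-<-trans lo hi))

block-index-unique : ∀ {M J J' c} → InBlock M J c → InBlock M J' c → J ≡ J'
block-index-unique (lo , hi) (lo' , hi') =
  ≤-antisym (block-index-≤ lo hi') (block-index-≤ lo' hi)

block-of-two : ∀ {J c} → InBlock 2 J c → c ≡ J * 2 ⊎ c ≡ suc (J * 2)
block-of-two (lo , hi) with m≤n⇒m<n∨m≡n (s≤s⁻¹ hi)
... | inj₁ c<1+2J = inj₁ (≤-antisym (s≤s⁻¹ c<1+2J) lo)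
... | inj₂ c≡1+2J = inj₂ c≡1+2J

record BlockSelector : Set where
  field
    pick       : ℕ → ℕ → ℕ
    pick-∈     : ∀ M J → 0 < M → InBlock M J (pick M J)
    half       : ℕ → ℕ
    pick-split : ∀ M J → pick (2 * M) J ≡ pick M (half J)

  pick-consistent : ∀ {M J J'} → 0 < M →
    InBlock M J' (pick (2 * M) J) → pick M J' ≡ pick (2 * M) J
  pick-consistent {M} {J} {J'} M>0 inJ' = begin
    pick M J'       ≡⟨ cong (pick M) (block-index-unique half-pick∈J' (pick-∈ M (half J) M>0)) ⟩
    pick M (half J) ≡⟨ sym (pick-split M J) ⟩
    pick (2 * M) J  ∎
    where
    open ≡-Reasoning
    half-pick∈J' : InBlock M J' (pick M (half J))
    half-pick∈J' = subst (InBlock M J') (pick-split M J) inJ'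

open BlockSelector

lowest : BlockSelector
lowest = record
  { pick       = λ M J → J * M
  ; pick-∈     = λ M J M>0 → ≤-refl , m<n+m (J * M) M>0
  ; half       = λ J → J * 2
  ; pick-split = λ M J → sym (*-assoc J 2 M)
  }

highest : BlockSelector
highest = record
  { pick       = λ M J → pred (suc J * M)
  ; pick-∈     = highest-∈
  ; half       = λ J → suc (J * 2)
  ; pick-split = λ M J → cong pred (sym (*-assoc (suc J) 2 M))
  }
  where
  highest-∈ : ∀ M J → 0 < M → InBlock M J (pred (suc J * M))
  highest-∈ (suc M) J _ = m≤n+m (J * suc M) M , ≤-refl

game-block-≤ : ∀ r (k : Fin r) (j : Fin (2 ^ (r ∸ suc (toℕ k)))) →
  suc (toℕ j) * 2 ^ suc (toℕ k) ≤ 2 ^ r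
game-block-≤ r k j = begin
  suc (toℕ j) * 2 ^ suc (toℕ k)            ≤⟨ *-monoˡ-≤ (2 ^ suc (toℕ k)) (toℕ<n j) ⟩
  2 ^ (r ∸ suc (toℕ k)) * 2 ^ suc (toℕ k)  ≡⟨ sym (^-distribˡ-+-* 2 (r ∸ suc (toℕ k)) (suc (toℕ k))) ⟩
  2 ^ (r ∸ suc (toℕ k) + suc (toℕ k))      ≡⟨ cong (2 ^_) (m∸n+n≡m (toℕ<n k)) ⟩
  2 ^ r                                    ∎
  where open ≤-Reasoning

bracketOf : ∀ r → BlockSelector → Bracket r
bracketOf r S = record
  { B         = λ t g → toℕ t ≡ᵇ winner g
  ; oneWinner = λ { (k , j) → sumFin-indicator (2 ^ r) (winner (k , j))
                                (<-≤-trans (proj₂ (winner-∈ (k , j))) (game-block-≤ r k j)) }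
  ; inGame    = λ { t (k , j) t-wins →
                    subst (InBlock (2 ^ suc (toℕ k)) (toℕ j)) (sym (≡ᵇ-true⇒≡ t-wins)) (winner-∈ (k , j)) }
  ; advance   = λ { t (k , j) (k' , j') rounds t∈g' t-wins →
                    let t≡w = ≡ᵇ-true⇒≡ t-wins in
                    ≡⇒≡ᵇ-true (trans t≡w (sym (winner-advances (toℕ k) (toℕ k') (toℕ j) (toℕ j')
                      (suc-injective rounds) (subst (InBlock (2 ^ suc (toℕ k')) (toℕ j')) t≡w t∈g')))) }
  }
  where
  winner : Game r → ℕ
  winner (k , j) = pick S (2 ^ suc (toℕ k)) (toℕ j)

  winner-∈ : ∀ (g : Game r) → InBlock (2 ^ round g) (toℕ (proj₂ g)) (winner g)
  winner-∈ (k , j) = pick-∈ S (2 ^ suc (toℕ k)) (toℕ j) (m^n>0 2 (suc (toℕ k)))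

  winner-advances : ∀ K K' J J' → K ≡ suc K' →
    InBlock (2 ^ suc K') J' (pick S (2 ^ suc K) J) → pick S (2 ^ suc K') J' ≡ pick S (2 ^ suc K) J
  winner-advances _ K' J J' refl = pick-consistent S (m^n>0 2 (suc K'))

firstRoundGame : ∀ {r} → Fin (2 ^ r) → Game (suc r)
firstRoundGame j = zero , j

agree : ∀ {r} → Bracket r → Bracket r → Team r → Game r → ℕ
agree E O t g = bit (B E t g) * bit (B O t g)

firstRoundScore : ∀ {r} → Bracket (suc r) → Bracket (suc r) → ℕ
firstRoundScore {r} E O =
  sumFin (teams (suc r)) (λ t → sumFin (2 ^ r) (λ j → agree E O t (firstRoundGame {r} j)))

firstRoundScore≤score : ∀ {r} (E O : Bracket (suc r)) → firstRoundScore E O ≤ score E O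
firstRoundScore≤score {r} E O = sumFin-mono (teams (suc r)) (λ t →
  ≤-trans (≤-reflexive (sumFin-cong (2 ^ r) (λ j → sym (*-identityˡ _)))) (m≤m+n _ _))

FirstRoundCover : ∀ {r} → Bracket (suc r) → Bracket (suc r) → Set
FirstRoundCover {r} E E' = ∀ (t : Team (suc r)) (j : Fin (2 ^ r)) → t ∈T (firstRoundGame {r} j) →
  B E t (firstRoundGame {r} j) ≡ true ⊎ B E' t (firstRoundGame {r} j) ≡ true

bit≤agree+agree : ∀ x y o → (o ≡ true → x ≡ true ⊎ y ≡ true) →
  bit o ≤ bit x * bit o + bit y * bit o
bit≤agree+agree x     y     false _       = z≤n
bit≤agree+agree true  y     true  _       = s≤s z≤n
bit≤agree+agree false true  true  _       = s≤s z≤n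
bit≤agree+agree false false true  covered with covered refl
... | inj₁ ()
... | inj₂ ()

cover⇒score-bound : ∀ {r} (E E' : Bracket (suc r)) → FirstRoundCover E E' →
  ∀ O → 2 ^ r ≤ score E O + score E' O
cover⇒score-bound {r} E E' cover O = begin
  2 ^ r
    ≡⟨ sym (trans (sumFin-const P 1) (*-identityʳ P)) ⟩
  sumFin P (λ _ → 1)
    ≡⟨ sym (sumFin-cong P (λ j → oneWinner O (firstRoundGame {r} j))) ⟩
  sumFin P (λ j → sumFin T (λ t → bit (B O t (firstRoundGame {r} j))))
    ≤⟨ sumFin-mono P (λ j → sumFin-mono T (λ t → bit≤agree+agree _ _ _
         (λ t-wins → cover t j (inGame O t (firstRoundGame {r} j) t-wins)))) ⟩
  sumFin P (λ j → sumFin T (λ t → both t j))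
    ≡⟨ sym (sumFin-swap T P both) ⟩
  sumFin T (λ t → sumFin P (both t))
    ≡⟨ sumFin-cong T (λ t → sumFin-+ P _ _) ⟩
  sumFin T (λ t → sumFin P (λ j → agree E O t (firstRoundGame {r} j)) + sumFin P (λ j → agree E' O t (firstRoundGame {r} j)))
    ≡⟨ sumFin-+ T _ _ ⟩
  firstRoundScore E O + firstRoundScore E' O
    ≤⟨ +-mono-≤ (firstRoundScore≤score E O) (firstRoundScore≤score E' O) ⟩
  score E O + score E' O ∎
  where
  open ≤-Reasoning
  P = 2 ^ r
  T = teams (suc r)
  both : Team (suc r) → Fin P → ℕ
  both t j = agree E O t (firstRoundGame {r} j) + agree E' O t (firstRoundGame {r} j)

lowest-highest-cover : ∀ r → FirstRoundCover (bracketOf (suc r) lowest) (bracketOf (suc r) highest)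
lowest-highest-cover r t j t∈g with block-of-two {toℕ j} t∈g
... | inj₁ t≡2j   = inj₁ (≡⇒≡ᵇ-true t≡2j)
... | inj₂ t≡2j+1 = inj₂ (≡⇒≡ᵇ-true t≡2j+1)

m+n≤2*[m⊔n] : ∀ m n → m + n ≤ 2 * (m ⊔ n)
m+n≤2*[m⊔n] m n = begin
  m + n                  ≤⟨ +-mono-≤ (m≤m⊔n m n) (m≤n⊔m m n) ⟩
  (m ⊔ n) + (m ⊔ n)      ≡⟨ cong ((m ⊔ n) +_) (sym (+-identityʳ (m ⊔ n))) ⟩
  2 * (m ⊔ n)            ∎
  where open ≤-Reasoning

proposition2 : ∀ (r : ℕ) → 1 ≤ r →
    Σ (Bracket r) (λ E → Σ (Bracket r) (λ E' →
    ∀ (O : Bracket r) → teams r ≤ 4 * (score E O ⊔ score E' O)))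
proposition2 (suc r) _ = E , E' , λ O → begin
  2 * 2 ^ r                          ≤⟨ *-monoʳ-≤ 2 (cover⇒score-bound E E' (lowest-highest-cover r) O) ⟩
  2 * (score E O + score E' O)       ≤⟨ *-monoʳ-≤ 2 (m+n≤2*[m⊔n] (score E O) (score E' O)) ⟩
  2 * (2 * (score E O ⊔ score E' O)) ≡⟨ sym (*-assoc 2 2 (score E O ⊔ score E' O)) ⟩
  4 * (score E O ⊔ score E' O)       ∎
  where
  open ≤-Reasoning
  E  = bracketOf (suc r) lowest
  E' = bracketOf (suc r) highest
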